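{- Let $p$ be an odd prime and $n\ge 6$ an even integer such that $n\neq 2l_1p$ for every positive integer $l_1$ and $n\neq p^{l_2}+1$ for every positive integer $l_2$. Let $$f_{n,2}(x)=2\sum_{j\geq 0}\binom{n-1}{2j+1}(x^j-x^{j+1})+2\sum_{j\geq 0}\binom{n}{2j}x^j\in\mathbb{F}_p[x],\qquad C_n(x):=f_{n,2}(x)-2n\,x^{n/2-1}.$$ Then, with $N=n/2-1$, $C_n(x)$ (which has degree less than $N$) viewed as an element of $\mathbb{F}_p[x]/(x^N-1)$ is a coterm polynomial.
   Context: Coefficients are reduced modulo $p$; binomial coefficients $\binom{a}{b}$ are $0$ when $b>a$. For a commutative ring $R$ with identity and $N\ge1$, a polynomial $a_0+a_1x+\cdots+a_{N-1}x^{N-1}\in R[x]/(x^N-1)$ is a coterm polynomial if $a_i=a_{N-i}$ for all $1\le i\le\lfloor N/2\rfloor$. -}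

module Defs where

open import Data.Bool.Base using (if_then_else_)
open import Data.Nat.Base as ℕ using (ℕ; zero; suc; _≡ᵇ_; _∸_)
open import Data.Nat.DivMod using (_%_; _/_)
open import Data.Nat.Combinatorics using (_C_)
open import Data.Integer.Base as ℤ using (ℤ; +_; _+_; _-_; _*_)
open import Data.Integer.Divisibility using (_∣_)

Σ< : ℕ → (ℕ → ℤ) → ℤ
Σ< zero    t = + 0
Σ< (suc B) t = Σ< B t + t B

δ : ℕ → ℕ → ℤ
δ j k = if j ≡ᵇ k then + 1 else + 0

-- A polynomial (over ℤ, later reduced mod p) is given by its coefficient
-- function ℕ → ℤ (coefficient of x^k).  Polynomials below have only
-- finitely many nonzero coefficients.

-- All terms with j > n vanish (binomial coefficients are 0), so the
-- sums are taken over j < n + 1.  Coefficient of x^k: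
f2coeff : ℕ → ℕ → ℤ
f2coeff n k =
  + 2 * Σ< (suc n) (λ j → + ((n ∸ 1) C (2 ℕ.* j ℕ.+ 1)) * (δ j k - δ (suc j) k))
  + + 2 * Σ< (suc n) (λ j → + (n C (2 ℕ.* j)) * δ j k)

Ccoeff : ℕ → ℕ → ℤ
Ccoeff n k = f2coeff n k - + (2 ℕ.* n) * δ (n / 2 ∸ 1) k

-- Image in R[x]/(x^N - 1): coefficient a_i (0 ≤ i < N) of the reduction
-- of a polynomial with coefficients c whose nonzero coefficients lie
-- among x^0 … x^(B-1):  a_i = Σ_{k < B, k ≡ i mod N} c_k.  (N ≥ 1.)
reduceMod : (N : ℕ) → (ℕ → ℤ) → (B : ℕ) → ℕ → ℤ
reduceMod zero    c B i = + 0   -- N = 0 is never used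
reduceMod (suc M) c B i = Σ< B (λ k → if (k % suc M) ≡ᵇ i then c k else + 0)

-- Coterm polynomial in F_p[x]/(x^N - 1), coefficients a_0 … a_{N-1}
-- represented by integers, equality in F_p being congruence mod p:
-- a_i = a_{N-i} for all 1 ≤ i ≤ ⌊N/2⌋.
IsCotermModP : (p N : ℕ) → (ℕ → ℤ) → Set
IsCotermModP p N a =
  (i : ℕ) → 1 ℕ.≤ i → i ℕ.≤ N / 2 → + p ∣ (a i - a (N ∸ i))

-- Over ℤ already, the x^k-coefficient of f_{n,2} telescopes by Pascal's rule to
-- 2·C(n, 2k+1).  For n = 2(N+1) the correction term −2n·x^N cancels the top
-- coefficient 2·C(n, n−1) = 2n, and all higher coefficients vanish, so C_n has
-- degree < N and is its own reduction mod x^N − 1.  Its coefficients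
-- 2·C(n, 2i+1) and 2·C(n, 2(N−i)+1) = 2·C(n, n−(2i+1)) agree, so C_n is coterm
-- over ℤ, hence over every 𝔽_p.
module Submission where

open import Defs
open import Data.Nat.Base using (ℕ; _≤_; _*_; _+_; _^_; _∸_; _/_)
open import Data.Nat.Divisibility using (_∣_)
open import Data.Nat.Primality using (Prime)
open import Relation.Binary.PropositionalEquality using (_≡_; _≢_)

open import Data.Bool.Base using (true; false; if_then_else_)
open import Data.Bool.Properties using (if-eta)
open import Data.Empty using (⊥-elim)
open import Data.Integer.Base as ℤ using (ℤ; +_)
import Data.Integer.Properties as ℤ
open import Data.Integer.Divisibility using () renaming (_∣_ to _∣ℤ_)
open import Data.Integer.Tactic.RingSolver using (solve-∀)
open import Data.Nat.Base using (zero; suc; _<_; _≡ᵇ_; _%_; z≤n; s≤s)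
open import Data.Nat.Combinatorics using (_C_; nCk≡nC[n∸k]; nC1≡n; k>n⇒nCk≡0; nCk+nC[k+1]≡[n+1]C[k+1])
open import Data.Nat.Divisibility using (divides; _∣0)
open import Data.Nat.DivMod using (m*n/n≡m; m<n⇒m%n≡m; m/n<m)
open import Data.Nat.Properties
open import Data.Nat.Tactic.RingSolver as ℕ-Solver using ()
open import Relation.Binary.PropositionalEquality
  using (refl; sym; trans; cong; cong₂; subst; ≢-sym; module ≡-Reasoning)
open import Data.Sum.Base using (inj₁; inj₂)
open import Relation.Nullary using (yes; no; contradiction)

δ-refl : ∀ k → δ k k ≡ + 1
δ-refl zero    = refl
δ-refl (suc k) = δ-refl k

δ-≢ : ∀ {j k} → j ≢ k → δ j k ≡ + 0
δ-≢ {zero}  {zero}  j≢k = ⊥-elim (j≢k refl)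
δ-≢ {zero}  {suc k} j≢k = refl
δ-≢ {suc j} {zero}  j≢k = refl
δ-≢ {suc j} {suc k} j≢k = δ-≢ (λ j≡k → j≢k (cong suc j≡k))

if-else-0≡*δ : ∀ j k (x : ℤ) → (if j ≡ᵇ k then x else + 0) ≡ x ℤ.* δ j k
if-else-0≡*δ j k x with j ≡ᵇ k
... | true  = sym (ℤ.*-identityʳ x)
... | false = sym (ℤ.*-zeroʳ x)

Σ<-cong : ∀ B {f g : ℕ → ℤ} → (∀ k → k < B → f k ≡ g k) → Σ< B f ≡ Σ< B g
Σ<-cong zero    f≗g = refl
Σ<-cong (suc B) f≗g = cong₂ ℤ._+_ (Σ<-cong B (λ k k<B → f≗g k (m<n⇒m<1+n k<B))) (f≗g B ≤-refl)

Σ<-zero : ∀ B {f : ℕ → ℤ} → (∀ k → k < B → f k ≡ + 0) → Σ< B f ≡ + 0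
Σ<-zero zero    f≗0 = refl
Σ<-zero (suc B) f≗0 = cong₂ ℤ._+_ (Σ<-zero B (λ k k<B → f≗0 k (m<n⇒m<1+n k<B))) (f≗0 B ≤-refl)

Σ<-sub : ∀ B (f g : ℕ → ℤ) → Σ< B (λ j → f j ℤ.- g j) ≡ Σ< B f ℤ.- Σ< B g
Σ<-sub zero    f g = refl
Σ<-sub (suc B) f g = trans (cong (ℤ._+ (f B ℤ.- g B)) (Σ<-sub B f g)) (interchange (Σ< B f) (Σ< B g) (f B) (g B))
  where
  interchange : ∀ a b c d → (a ℤ.- b) ℤ.+ (c ℤ.- d) ≡ (a ℤ.+ c) ℤ.- (b ℤ.+ d)
  interchange = solve-∀

Σ<-sift : ∀ B (t : ℕ → ℤ) {k} → k < B → Σ< B (λ j → t j ℤ.* δ j k) ≡ t k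
Σ<-sift (suc B) t {k} k<1+B with k ≟ B
... | yes refl = begin
  Σ< B (λ j → t j ℤ.* δ j k) ℤ.+ t k ℤ.* δ k k
    ≡⟨ cong₂ ℤ._+_ (Σ<-zero B off-diagonal) (cong (t k ℤ.*_) (δ-refl k)) ⟩
  + 0 ℤ.+ t k ℤ.* + 1                           ≡⟨ trans (ℤ.+-identityˡ _) (ℤ.*-identityʳ (t k)) ⟩
  t k                                           ∎
  where
  open ≡-Reasoning
  off-diagonal : ∀ j → j < k → t j ℤ.* δ j k ≡ + 0
  off-diagonal j j<k = trans (cong (t j ℤ.*_) (δ-≢ (<⇒≢ j<k))) (ℤ.*-zeroʳ (t j))
... | no k≢B = begin
  Σ< B (λ j → t j ℤ.* δ j k) ℤ.+ t B ℤ.* δ B k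
    ≡⟨ cong₂ ℤ._+_ (Σ<-sift B t (≤∧≢⇒< (≤-pred k<1+B) k≢B)) (cong (t B ℤ.*_) (δ-≢ (≢-sym k≢B))) ⟩
  t k ℤ.+ t B ℤ.* + 0                           ≡⟨ trans (cong (ℤ._+_ (t k)) (ℤ.*-zeroʳ (t B))) (ℤ.+-identityʳ (t k)) ⟩
  t k                                           ∎
  where
  open ≡-Reasoning

reduceMod-of-degree< : ∀ N (c : ℕ → ℤ) B {i} → (∀ {k} → N ≤ k → k < B → c k ≡ + 0) → i < N → N ≤ B →
                       reduceMod N c B i ≡ c i
reduceMod-of-degree< (suc M) c B {i} c-high i<N N≤B =
  trans (Σ<-cong B selects) (Σ<-sift B c (<-≤-trans i<N N≤B))
  where
  selects : ∀ k → k < B → (if k % suc M ≡ᵇ i then c k else + 0) ≡ c k ℤ.* δ k i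
  selects k k<B with k <? suc M
  ... | yes k<N = trans (cong (λ r → if r ≡ᵇ i then c k else + 0) (m<n⇒m%n≡m k<N)) (if-else-0≡*δ k i (c k))
  ... | no k≮N = trans (cong (λ x → if k % suc M ≡ᵇ i then x else + 0) ck≡0)
                       (trans (if-eta (k % suc M ≡ᵇ i)) (sym (cong (ℤ._* δ k i) ck≡0)))
    where
    ck≡0 : c k ≡ + 0
    ck≡0 = c-high (≮⇒≥ k≮N) k<B

0<m≤n/2⇒m<n : ∀ {m n} → 1 ≤ m → m ≤ n / 2 → m < n
0<m≤n/2⇒m<n {n = zero}  1≤m m≤0   = contradiction (≤-trans 1≤m m≤0) λ ()
0<m≤n/2⇒m<n {n = suc n} _   m≤n/2 = ≤-<-trans m≤n/2 (m/n<m (suc n) 2 (s≤s (s≤s z≤n)))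

IsCotermModP-of-palindromic : ∀ p N (a : ℕ → ℤ) → (∀ {i} → 1 ≤ i → i < N → a i ≡ a (N ∸ i)) →
                              IsCotermModP p N a
IsCotermModP-of-palindromic p N a palindromic i 1≤i i≤N/2 = subst (+ p ∣ℤ_) (sym a[i]-a[N∸i]≡0) (p ∣0)
  where
  a[i]-a[N∸i]≡0 : a i ℤ.- a (N ∸ i) ≡ + 0
  a[i]-a[N∸i]≡0 = trans (cong (ℤ._-_ (a i)) (sym (palindromic 1≤i (0<m≤n/2⇒m<n 1≤i i≤N/2)))) (ℤ.+-inverseʳ (a i))

pascal-ℤ : ∀ n a → + (suc n C suc a) ≡ + (n C a) ℤ.+ + (n C suc a)
pascal-ℤ n a = trans (cong +_ (sym (nCk+nC[k+1]≡[n+1]C[k+1] n a))) (ℤ.pos-+ (n C a) (n C suc a))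

f2coeff≡2·C[n,2k+1] : ∀ n k → k ≤ suc n → f2coeff (suc n) k ≡ + 2 ℤ.* + (suc n C (2 * k + 1))
f2coeff≡2·C[n,2k+1] n k k≤1+n = begin
  f2coeff (suc n) k                                     ≡⟨ ℤ.*-distribˡ-+ (+ 2) X Y ⟨
  + 2 ℤ.* (X ℤ.+ Y)                                     ≡⟨ cong (λ x → + 2 ℤ.* (x ℤ.+ Y)) X≡t[k]-L ⟩
  + 2 ℤ.* (t k ℤ.- L ℤ.+ Y)                             ≡⟨ cong (λ y → + 2 ℤ.* (t k ℤ.- L ℤ.+ y)) Y≡C[1+n,2k] ⟩
  + 2 ℤ.* (t k ℤ.- L ℤ.+ + (suc n C (2 * k)))           ≡⟨ cong (+ 2 ℤ.*_) (telescope k k≤1+n) ⟩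
  + 2 ℤ.* + (suc n C (2 * k + 1))                       ∎
  where
  open ≡-Reasoning
  B = suc (suc n)
  k<B : k < B
  k<B = s≤s k≤1+n
  t : ℕ → ℤ
  t j = + (n C (2 * j + 1))
  X Y L : ℤ
  X = Σ< B (λ j → t j ℤ.* (δ j k ℤ.- δ (suc j) k))
  Y = Σ< B (λ j → + (suc n C (2 * j)) ℤ.* δ j k)
  L = Σ< B (λ j → t j ℤ.* δ (suc j) k)
  X≡t[k]-L : X ≡ t k ℤ.- L
  X≡t[k]-L = begin
    X                                                   ≡⟨ Σ<-cong B (λ j _ → *-distribˡ-- (t j) (δ j k) (δ (suc j) k)) ⟩
    Σ< B (λ j → t j ℤ.* δ j k ℤ.- t j ℤ.* δ (suc j) k)  ≡⟨ Σ<-sub B _ _ ⟩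
    Σ< B (λ j → t j ℤ.* δ j k) ℤ.- L                    ≡⟨ cong (ℤ._- L) (Σ<-sift B t k<B) ⟩
    t k ℤ.- L                                           ∎
    where
    *-distribˡ-- : ∀ x y z → x ℤ.* (y ℤ.- z) ≡ x ℤ.* y ℤ.- x ℤ.* z
    *-distribˡ-- = solve-∀
  Y≡C[1+n,2k] : Y ≡ + (suc n C (2 * k))
  Y≡C[1+n,2k] = Σ<-sift B (λ j → + (suc n C (2 * j))) k<B
  telescope : ∀ k → k ≤ suc n →
              t k ℤ.- Σ< B (λ j → t j ℤ.* δ (suc j) k) ℤ.+ + (suc n C (2 * k)) ≡ + (suc n C (2 * k + 1))
  telescope zero _ = begin
    t 0 ℤ.- Σ< B (λ j → t j ℤ.* + 0) ℤ.+ + (suc n C 0) ≡⟨ cong (λ l → t 0 ℤ.- l ℤ.+ + (n C 0)) (Σ<-zero B (λ j _ → ℤ.*-zeroʳ (t j))) ⟩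
    + (n C 1) ℤ.- + 0 ℤ.+ + (n C 0)                    ≡⟨ drop-0 (+ (n C 1)) (+ (n C 0)) ⟩
    + (n C 0) ℤ.+ + (n C 1)                            ≡⟨ pascal-ℤ n 0 ⟨
    + (suc n C 1)                                      ∎
    where
    drop-0 : ∀ b a → b ℤ.- + 0 ℤ.+ a ≡ a ℤ.+ b
    drop-0 = solve-∀
  telescope (suc k) k<1+n = begin
    t (suc k) ℤ.- Σ< B (λ j → t j ℤ.* δ j k) ℤ.+ + (suc n C (2 * suc k))
      ≡⟨ cong (λ l → t (suc k) ℤ.- l ℤ.+ + (suc n C (2 * suc k))) (Σ<-sift B t (m<n⇒m<1+n k<1+n)) ⟩
    t (suc k) ℤ.- t k ℤ.+ + (suc n C (2 * suc k))
      ≡⟨ cong₂ (λ i j → + (n C i) ℤ.- t k ℤ.+ + (suc n C j)) 2[1+k]+1≡2+a 2[1+k]≡1+a ⟩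
    + (n C suc (suc a)) ℤ.- + (n C a) ℤ.+ + (suc n C suc a)
      ≡⟨ cong (λ x → + (n C suc (suc a)) ℤ.- + (n C a) ℤ.+ x) (pascal-ℤ n a) ⟩
    + (n C suc (suc a)) ℤ.- + (n C a) ℤ.+ (+ (n C a) ℤ.+ + (n C suc a))
      ≡⟨ cancel (+ (n C a)) (+ (n C suc a)) (+ (n C suc (suc a))) ⟩
    + (n C suc a) ℤ.+ + (n C suc (suc a))
      ≡⟨ pascal-ℤ n (suc a) ⟨
    + (suc n C suc (suc a))
      ≡⟨ cong (λ i → + (suc n C i)) 2[1+k]+1≡2+a ⟨
    + (suc n C (2 * suc k + 1))
      ∎
    where
    a = 2 * k + 1
    2[1+k]≡1+a : 2 * suc k ≡ suc a
    2[1+k]≡1+a = trans (*-suc 2 k) (cong suc (+-comm 1 (2 * k)))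
    2[1+k]+1≡2+a : 2 * suc k + 1 ≡ suc (suc a)
    2[1+k]+1≡2+a = trans (cong (_+ 1) 2[1+k]≡1+a) (+-comm (suc a) 1)
    cancel : ∀ a b c → c ℤ.- a ℤ.+ (a ℤ.+ b) ≡ b ℤ.+ c
    cancel = solve-∀

C[2N+2,2[N∸i]+1]≡C[2N+2,2i+1] : ∀ N i → i ≤ N →
                                suc N * 2 C (2 * (N ∸ i) + 1) ≡ suc N * 2 C (2 * i + 1)
C[2N+2,2[N∸i]+1]≡C[2N+2,2i+1] N i i≤N = sym (begin
  n C (2 * i + 1)                             ≡⟨ nCk≡nC[n∸k] (subst (2 * i + 1 ≤_) (sym n≡l+r) (m≤m+n _ _)) ⟩
  n C (n ∸ (2 * i + 1))                       ≡⟨ cong (λ m → n C (m ∸ (2 * i + 1))) n≡l+r ⟩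
  n C (2 * i + 1 + (2 * d + 1) ∸ (2 * i + 1)) ≡⟨ cong (n C_) (m+n∸m≡n (2 * i + 1) (2 * d + 1)) ⟩
  n C (2 * d + 1)                             ∎)
  where
  open ≡-Reasoning
  n = suc N * 2
  d = N ∸ i
  n≡l+r : n ≡ 2 * i + 1 + (2 * d + 1)
  n≡l+r = trans (cong (λ m → suc m * 2) (sym (m+[n∸m]≡n i≤N))) (split i d)
    where
    split : ∀ i d → suc (i + d) * 2 ≡ 2 * i + 1 + (2 * d + 1)
    split = ℕ-Solver.solve-∀

y-x*0≡y : ∀ y x → y ℤ.- x ℤ.* + 0 ≡ y
y-x*0≡y = solve-∀

module _ (N : ℕ) where
  private
    n = suc N * 2

  Ccoeff-unfold : ∀ k → Ccoeff n k ≡ f2coeff n k ℤ.- + (2 * n) ℤ.* δ N k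
  Ccoeff-unfold k = cong (λ m → f2coeff n k ℤ.- + (2 * n) ℤ.* δ (m ∸ 1) k) (m*n/n≡m (suc N) 2)

  N<n : N < n
  N<n = s≤s (≤-trans (m≤m*n N 2) (n≤1+n _))

  Ccoeff-below : ∀ {k} → k < N → Ccoeff n k ≡ + 2 ℤ.* + (n C (2 * k + 1))
  Ccoeff-below {k} k<N = begin
    Ccoeff n k                             ≡⟨ Ccoeff-unfold k ⟩
    f2coeff n k ℤ.- + (2 * n) ℤ.* δ N k    ≡⟨ cong (λ d → f2coeff n k ℤ.- + (2 * n) ℤ.* d) (δ-≢ (≢-sym (<⇒≢ k<N))) ⟩
    f2coeff n k ℤ.- + (2 * n) ℤ.* + 0      ≡⟨ y-x*0≡y (f2coeff n k) (+ (2 * n)) ⟩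
    f2coeff n k                            ≡⟨ f2coeff≡2·C[n,2k+1] _ k (<⇒≤ (<-trans k<N N<n)) ⟩
    + 2 ℤ.* + (n C (2 * k + 1))            ∎
    where open ≡-Reasoning

  Ccoeff-top : Ccoeff n N ≡ + 0
  Ccoeff-top = begin
    Ccoeff n N                                        ≡⟨ Ccoeff-unfold N ⟩
    f2coeff n N ℤ.- + (2 * n) ℤ.* δ N N               ≡⟨ cong₂ (λ f d → f ℤ.- + (2 * n) ℤ.* d) (f2coeff≡2·C[n,2k+1] _ N (<⇒≤ N<n)) (δ-refl N) ⟩
    + 2 ℤ.* + (n C (2 * N + 1)) ℤ.- + (2 * n) ℤ.* + 1 ≡⟨ cong₂ (λ c m → + 2 ℤ.* + c ℤ.- m ℤ.* + 1) C[n,n-1]≡n (ℤ.pos-* 2 n) ⟩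
    + 2 ℤ.* + n ℤ.- + 2 ℤ.* + n ℤ.* + 1               ≡⟨ cancel (+ n) ⟩
    + 0                                               ∎
    where
    open ≡-Reasoning
    C[n,n-1]≡n : n C (2 * N + 1) ≡ n
    C[n,n-1]≡n = trans (C[2N+2,2[N∸i]+1]≡C[2N+2,2i+1] N 0 z≤n) (nC1≡n n)
    cancel : ∀ x → + 2 ℤ.* x ℤ.- + 2 ℤ.* x ℤ.* + 1 ≡ + 0
    cancel = solve-∀

  Ccoeff-above : ∀ {k} → N < k → k ≤ n → Ccoeff n k ≡ + 0
  Ccoeff-above {k} N<k k≤n = begin
    Ccoeff n k                             ≡⟨ Ccoeff-unfold k ⟩
    f2coeff n k ℤ.- + (2 * n) ℤ.* δ N k    ≡⟨ cong₂ (λ f d → f ℤ.- + (2 * n) ℤ.* d) (f2coeff≡2·C[n,2k+1] _ k k≤n) (δ-≢ (<⇒≢ N<k)) ⟩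
    + 2 ℤ.* + (n C (2 * k + 1)) ℤ.- + (2 * n) ℤ.* + 0 ≡⟨ cong (λ c → + 2 ℤ.* + c ℤ.- + (2 * n) ℤ.* + 0) (k>n⇒nCk≡0 n<2k+1) ⟩
    + 2 ℤ.* + 0 ℤ.- + (2 * n) ℤ.* + 0      ≡⟨ y-x*0≡y (+ 2 ℤ.* + 0) (+ (2 * n)) ⟩
    + 0                                    ∎
    where
    open ≡-Reasoning
    n<2k+1 : n < 2 * k + 1
    n<2k+1 = subst (n <_) (+-comm 1 (2 * k)) (s≤s (subst (_≤ 2 * k) (*-comm 2 (suc N)) (*-monoʳ-≤ 2 N<k)))

  Ccoeff-high : ∀ {k} → N ≤ k → k ≤ n → Ccoeff n k ≡ + 0
  Ccoeff-high N≤k k≤n with m≤n⇒m<n∨m≡n N≤k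
  ... | inj₁ N<k  = Ccoeff-above N<k k≤n
  ... | inj₂ refl = Ccoeff-top

  Ccoeff-palindromic : ∀ {i} → 1 ≤ i → i < N → Ccoeff n i ≡ Ccoeff n (N ∸ i)
  Ccoeff-palindromic {i} 1≤i i<N = begin
    Ccoeff n i                          ≡⟨ Ccoeff-below i<N ⟩
    + 2 ℤ.* + (n C (2 * i + 1))         ≡⟨ cong (λ c → + 2 ℤ.* + c) (C[2N+2,2[N∸i]+1]≡C[2N+2,2i+1] N i (<⇒≤ i<N)) ⟨
    + 2 ℤ.* + (n C (2 * (N ∸ i) + 1))   ≡⟨ Ccoeff-below (∸-monoʳ-< 1≤i (<⇒≤ i<N)) ⟨
    Ccoeff n (N ∸ i)                    ∎
    where open ≡-Reasoning

  reduceMod-Ccoeff : ∀ {i} → i < N → reduceMod N (Ccoeff n) (n + 1) i ≡ Ccoeff n i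
  reduceMod-Ccoeff i<N = reduceMod-of-degree< N (Ccoeff n) (n + 1) vanishes i<N (≤-trans (<⇒≤ N<n) (m≤m+n n 1))
    where
    vanishes : ∀ {k} → N ≤ k → k < n + 1 → Ccoeff n k ≡ + 0
    vanishes {k} N≤k k<n+1 = Ccoeff-high N≤k (m<1+n⇒m≤n (subst (k <_) (+-comm n 1) k<n+1))

  reduceMod-Ccoeff-coterm : ∀ p → IsCotermModP p N (reduceMod N (Ccoeff n) (n + 1))
  reduceMod-Ccoeff-coterm p = IsCotermModP-of-palindromic p N _ λ {i} 1≤i i<N → begin
    reduceMod N (Ccoeff n) (n + 1) i       ≡⟨ reduceMod-Ccoeff i<N ⟩
    Ccoeff n i                             ≡⟨ Ccoeff-palindromic 1≤i i<N ⟩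
    Ccoeff n (N ∸ i)                       ≡⟨ reduceMod-Ccoeff (∸-monoʳ-< 1≤i (<⇒≤ i<N)) ⟨
    reduceMod N (Ccoeff n) (n + 1) (N ∸ i) ∎
    where open ≡-Reasoning

theorem5p9 : (p n : ℕ) → Prime p → p ≢ 2 → 6 ≤ n → 2 ∣ n
    → ((l₁ : ℕ) → 1 ≤ l₁ → n ≢ 2 * l₁ * p)
    → ((l₂ : ℕ) → 1 ≤ l₂ → n ≢ p ^ l₂ + 1)
    → IsCotermModP p (n / 2 ∸ 1) (reduceMod (n / 2 ∸ 1) (Ccoeff n) (n + 1))
theorem5p9 p .(0 * 2)     _ _ () (divides zero refl)    _ _
theorem5p9 p .(suc N * 2) _ _ _  (divides (suc N) refl) _ _ =
  subst (λ M → IsCotermModP p M (reduceMod M (Ccoeff (suc N * 2)) (suc N * 2 + 1)))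
        (cong (_∸ 1) (sym (m*n/n≡m (suc N) 2)))
        (reduceMod-Ccoeff-coterm N p)
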